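{- For every nonnegative integer $n$, $\widehat{C}_{3,4,n}=\frac{1}{2\sqrt5}\left((1+\sqrt5)(2-\sqrt5)^n-(1-\sqrt5)(2+\sqrt5)^n\right)$.
   Context: A $3$-dimensional balanced ballot path of length $3n$ is a sequence of $3n$ standard unit vectors of $\mathbb{R}^3$, each of $\vec e_1,\vec e_2,\vec e_3$ occurring exactly $n$ times, such that every intermediate point (partial sum, including the origin) $(x_1,x_2,x_3)$ satisfies $x_1\ge x_2\ge x_3$. The semisymmetric height of a point is $g_3(\vec x)=2x_1-2x_3$, and the semisymmetric height of a path is the maximum of $g_3$ over its intermediate points (the empty path has height $0$). $\widehat{C}_{3,u,n}$ denotes the number of $3$-dimensional balanced ballot paths of length $3n$ with semisymmetric height at most $u$. -}

module Defs where

open import Data.Nat using (ℕ; zero; suc; _+_; _*_; _∸_; _≤_; _≥_; _≤?_)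
open import Data.Fin using (Fin; zero; suc)
open import Data.Fin.Properties using () renaming (_≟_ to _≟F_)
open import Data.Integer as ℤ using (ℤ; +_)
open import Data.List using (List; []; _∷_; length; filter; map; concatMap)
open import Data.List.Relation.Unary.All using (All; all?)
open import Data.Product using (_×_; _,_)
open import Relation.Nullary using (Dec; yes; no)
open import Relation.Nullary.Decidable using (_×-dec_)
open import Relation.Binary.PropositionalEquality using (_≡_)
open import Data.Nat.Properties using () renaming (_≟_ to _≟ℕ_)

-- Points of ℕ³ (all intermediate points of a path starting at the origin
-- have nonnegative coordinates).
Point : Set
Point = ℕ × ℕ × ℕ

origin : Point
origin = 0 , 0 , 0

Step : Set
Step = Fin 3

move : Point → Step → Point
move (x₁ , x₂ , x₃) zero             = suc x₁ , x₂ , x₃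
move (x₁ , x₂ , x₃) (suc zero)       = x₁ , suc x₂ , x₃
move (x₁ , x₂ , x₃) (suc (suc zero)) = x₁ , x₂ , suc x₃

points : Point → List Step → List Point
points p []       = p ∷ []
points p (s ∷ w)  = p ∷ points (move p s) w

occ : Step → List Step → ℕ
occ s []      = 0
occ s (t ∷ w) with s ≟F t
... | yes _ = suc (occ s w)
... | no  _ = occ s w

Ballot : Point → Set
Ballot (x₁ , x₂ , x₃) = x₁ ≥ x₂ × x₂ ≥ x₃

-- Semisymmetric height g₃(x) = 2x₁ - 2x₃ (exact subtraction under Ballot).
g₃ : Point → ℕ
g₃ (x₁ , x₂ , x₃) = 2 * x₁ ∸ 2 * x₃

-- w is a 3-dimensional balanced ballot path of length 3n with
-- semisymmetric height at most u (height = max of g₃ over the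
-- intermediate points, so "≤ u" means every point has g₃ ≤ u).
Good : ℕ → ℕ → List Step → Set
Good u n w =
  All (λ p → Ballot p × g₃ p ≤ u) (points origin w)
  × occ zero w ≡ n × occ (suc zero) w ≡ n × occ (suc (suc zero)) w ≡ n

ballot? : (p : Point) → Dec (Ballot p)
ballot? (x₁ , x₂ , x₃) = (x₂ ≤? x₁) ×-dec (x₃ ≤? x₂)

good? : (u n : ℕ) → (w : List Step) → Dec (Good u n w)
good? u n w =
  all? (λ p → ballot? p ×-dec (g₃ p ≤? u)) (points origin w)
  ×-dec (occ zero w ≟ℕ n ×-dec (occ (suc zero) w ≟ℕ n ×-dec occ (suc (suc zero)) w ≟ℕ n))

words : ℕ → List (List Step)
words zero    = [] ∷ []
words (suc k) = concatMap (λ w → map (_∷ w) (zero ∷ suc zero ∷ suc (suc zero) ∷ [])) (words k)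

Chat : ℕ → ℕ → ℕ
Chat u n = length (filter (good? u n) (words (3 * n)))

-- ℤ[√5]: the pair (a , b) represents a + b√5.
ℤ√5 : Set
ℤ√5 = ℤ × ℤ

infixl 7 _⊗_
infixl 6 _⊕_ _⊖_
_⊕_ : ℤ√5 → ℤ√5 → ℤ√5
(a , b) ⊕ (c , d) = a ℤ.+ c , b ℤ.+ d

_⊖_ : ℤ√5 → ℤ√5 → ℤ√5
(a , b) ⊖ (c , d) = a ℤ.- c , b ℤ.- d

_⊗_ : ℤ√5 → ℤ√5 → ℤ√5
(a , b) ⊗ (c , d) = a ℤ.* c ℤ.+ + 5 ℤ.* (b ℤ.* d) , a ℤ.* d ℤ.+ b ℤ.* c

_^√_ : ℤ√5 → ℕ → ℤ√5
x ^√ zero  = + 1 , + 0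
x ^√ suc n = x ⊗ (x ^√ n)

ι : ℕ → ℤ√5
ι m = + m , + 0

-- A path of semisymmetric height at most 4 stays within x₁ − x₃ ≤ 2, so up to the
-- diagonal shift (1,1,1) it only visits the six points (0,0,0), (1,0,0), (1,1,0),
-- (2,0,0), (2,1,0), (2,2,0), and counting such paths is counting walks in a finite
-- graph.  Grouping the steps in threes, the numbers aₙ of excursions of length 3n from
-- the origin and eₙ from (2,1,0) back to the diagonal satisfy aₙ₊₁ = aₙ + 2eₙ and
-- eₙ₊₁ = 2aₙ + 3eₙ, a system with eigenvalues 2 ± √5.  Writing (2 − √5)ⁿ = pₙ + qₙ√5,
-- induction gives aₙ = pₙ + qₙ and eₙ = −2qₙ; as (2 + √5)ⁿ is the conjugate pₙ − qₙ√5,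
-- the right-hand side equals 2√5 (pₙ + qₙ).
module Submission where

open import Defs
open import Data.Nat using (ℕ; zero; suc)
open import Data.Integer using (+_; -_)
open import Data.Product using (_×_; _,_; proj₁; proj₂)
open import Relation.Binary.PropositionalEquality
  using (_≡_; refl; sym; trans; cong; cong₂; subst; module ≡-Reasoning)

open ≡-Reasoning

module Excursions where
  open import Data.Nat using (_+_; _*_; _∸_; _≤_; _≤?_; s≤s; s≤s⁻¹)
  open import Data.Nat.Properties using (_≟_; +-identityʳ; +-suc; suc-injective; *-suc; *-cancelˡ-≡)
  open import Data.Nat.ListAction using (sum)
  open import Data.Nat.ListAction.Properties using (sum-++)
  open import Data.Nat.Tactic.RingSolver using (solve-∀)
  open import Data.Fin using (zero; suc)
  open import Data.List using (List; []; _∷_; _++_; length; filter; map; concatMap; foldl)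
  open import Data.List.Properties using (filter-none; map-cong; map-∘; map-++)
  open import Data.List.Relation.Unary.All as All using (All; []; _∷_; all?; universal)
  open import Data.List.Relation.Unary.All.Properties using (map⁺; map⁻; concat⁺)
  open import Data.Product.Function.NonDependent.Propositional using (_×-⇔_)
  open import Function using (_∘_; _⇔_; mk⇔; Equivalence)
  open import Level using (0ℓ)
  open import Relation.Nullary using (Dec; ¬_; yes; no; contradiction)
  open import Relation.Nullary.Decidable using (_×-dec_)
  open import Relation.Unary using (Pred; Decidable)

  open Equivalence using (to; from)

  indicator : {P : Set} → Dec P → ℕ
  indicator (yes _) = 1
  indicator (no _)  = 0

  -- Unlike length ∘ filter, this unfolds identically on (P? ∘ f) x and P? (f x).
  count : {A : Set} {P : Pred A 0ℓ} → Decidable P → List A → ℕ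
  count P? []       = 0
  count P? (x ∷ xs) = indicator (P? x) + count P? xs

  module _ {A : Set} where

    module _ {P : Pred A 0ℓ} (P? : Decidable P) where

      length-filter≡count : ∀ xs → length (filter P? xs) ≡ count P? xs
      length-filter≡count []       = refl
      length-filter≡count (x ∷ xs) with P? x
      ... | yes _ = cong suc (length-filter≡count xs)
      ... | no _  = length-filter≡count xs

      count-cong : {Q : Pred A 0ℓ} (Q? : Decidable Q) →
                   ∀ {xs} → All (λ x → P x ⇔ Q x) xs → count P? xs ≡ count Q? xs
      count-cong Q? [] = refl
      count-cong Q? {x ∷ xs} (P⇔Q ∷ P⇔Q-elsewhere) with P? x | Q? x
      ... | yes _  | yes _  = cong suc (count-cong Q? P⇔Q-elsewhere)
      ... | no _   | no _   = count-cong Q? P⇔Q-elsewhere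
      ... | yes px | no ¬qx = contradiction (to P⇔Q px) ¬qx
      ... | no ¬px | yes qx = contradiction (from P⇔Q qx) ¬px

    sum-map-filter : {P : Pred A 0ℓ} (P? : Decidable P) (f : A → ℕ) → (∀ {x} → ¬ P x → f x ≡ 0) →
                     ∀ xs → sum (map f (filter P? xs)) ≡ sum (map f xs)
    sum-map-filter P? f f-vanishes []       = refl
    sum-map-filter P? f f-vanishes (x ∷ xs) with P? x
    ... | yes _  = cong (_+_ (f x)) (sum-map-filter P? f f-vanishes xs)
    ... | no ¬px = trans (sum-map-filter P? f f-vanishes xs) (cong (_+ sum (map f xs)) (sym (f-vanishes ¬px)))

    sum-map-concatMap : ∀ {B : Set} (f : A → ℕ) (g : B → List A) xs →
                        sum (map f (concatMap g xs)) ≡ sum (map (sum ∘ map f ∘ g) xs)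
    sum-map-concatMap f g []       = refl
    sum-map-concatMap f g (x ∷ xs) = begin
      sum (map f (g x ++ concatMap g xs))              ≡⟨ cong sum (map-++ f (g x) _) ⟩
      sum (map f (g x) ++ map f (concatMap g xs))      ≡⟨ sum-++ (map f (g x)) _ ⟩
      sum (map f (g x)) + sum (map f (concatMap g xs)) ≡⟨ cong (_+_ (sum (map f (g x)))) (sum-map-concatMap f g xs) ⟩
      sum (map f (g x)) + sum (map (sum ∘ map f ∘ g) xs) ∎

  steps : List Step
  steps = zero ∷ suc zero ∷ suc (suc zero) ∷ []

  count-words-suc : ∀ {P : Pred (List Step) 0ℓ} (P? : Decidable P) k →
                    count P? (words (suc k)) ≡ sum (map (λ t → count (P? ∘ (t ∷_)) (words k)) steps)
  count-words-suc P? k = prepend (words k)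
    where
    interleave : ∀ c₁ c₂ c₃ r₁ r₂ r₃ →
      c₁ + (c₂ + (c₃ + (r₁ + (r₂ + (r₃ + 0))))) ≡ (c₁ + r₁) + ((c₂ + r₂) + ((c₃ + r₃) + 0))
    interleave = solve-∀
    prepend : ∀ ws → count P? (concatMap (λ w → map (_∷ w) steps) ws) ≡
                     sum (map (λ t → count (P? ∘ (t ∷_)) ws) steps)
    prepend []       = refl
    prepend (w ∷ ws) = trans (cong (λ n → c₁ + (c₂ + (c₃ + n))) (prepend ws)) (interleave c₁ c₂ c₃ _ _ _)
      where
      c₁ c₂ c₃ : ℕ
      c₁ = indicator (P? (zero ∷ w))
      c₂ = indicator (P? (suc zero ∷ w))
      c₃ = indicator (P? (suc (suc zero) ∷ w))

  words-length : ∀ k → All (λ w → length w ≡ k) (words k)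
  words-length zero    = refl ∷ []
  words-length (suc k) =
    concat⁺ (map⁺ (All.map (λ {w} len → map⁺ {f = _∷ w} (universal (λ _ → cong suc len) steps)) (words-length k)))

  Admissible : ℕ → Point → Set
  Admissible u p = Ballot p × g₃ p ≤ u

  admissible? : ∀ u → Decidable (Admissible u)
  admissible? u p = ballot? p ×-dec (g₃ p ≤? u)

  Diagonal : Point → Set
  Diagonal (x₁ , x₂ , x₃) = x₁ ≡ x₂ × x₂ ≡ x₃

  diagonal? : Decidable Diagonal
  diagonal? (x₁ , x₂ , x₃) = (x₁ ≟ x₂) ×-dec (x₂ ≟ x₃)

  -- Ending anywhere on the diagonal, rather than at a prescribed point, makes this
  -- invariant under the shift by (1,1,1).
  Excursion : ℕ → Point → List Step → Set
  Excursion u p w = All (Admissible u) (points p w) × Diagonal (foldl move p w)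

  excursion? : ∀ u p → Decidable (Excursion u p)
  excursion? u p w = all? (admissible? u) (points p w) ×-dec diagonal? (foldl move p w)

  excursions : ℕ → Point → ℕ → ℕ
  excursions u p k = count (excursion? u p) (words k)

  excursion-admissible : ∀ {u p} w → Excursion u p w → Admissible u p
  excursion-admissible []      (adm ∷ _ , _) = adm
  excursion-admissible (_ ∷ _) (adm ∷ _ , _) = adm

  excursion-∷ : ∀ {u p} → Admissible u p → ∀ t w → Excursion u p (t ∷ w) ⇔ Excursion u (move p t) w
  excursion-∷ adm t w = mk⇔ (λ { (_ ∷ adms , diag) → adms , diag }) (λ (adms , diag) → adm ∷ adms , diag)

  excursions-inadmissible : ∀ {u p} → ¬ Admissible u p → ∀ k → excursions u p k ≡ 0
  excursions-inadmissible {u} {p} ¬adm k =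
    trans (sym (length-filter≡count (excursion? u p) (words k)))
          (cong length (filter-none (excursion? u p) (universal (λ w → ¬adm ∘ excursion-admissible w) (words k))))

  shift : Point → Point
  shift (x₁ , x₂ , x₃) = suc x₁ , suc x₂ , suc x₃

  move-shift : ∀ p t → move (shift p) t ≡ shift (move p t)
  move-shift p zero             = refl
  move-shift p (suc zero)       = refl
  move-shift p (suc (suc zero)) = refl

  points-shift : ∀ p w → points (shift p) w ≡ map shift (points p w)
  points-shift p []      = refl
  points-shift p (t ∷ w) =
    cong (shift p ∷_) (trans (cong (λ q → points q w) (move-shift p t)) (points-shift (move p t) w))

  foldl-shift : ∀ p w → foldl move (shift p) w ≡ shift (foldl move p w)
  foldl-shift p []      = refl
  foldl-shift p (t ∷ w) = trans (cong (λ q → foldl move q w) (move-shift p t)) (foldl-shift (move p t) w)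

  g₃-shift : ∀ p → g₃ (shift p) ≡ g₃ p
  g₃-shift (x₁ , _ , x₃) = cong₂ _∸_ (*-suc 2 x₁) (*-suc 2 x₃)

  admissible-shift : ∀ {u} p → Admissible u (shift p) ⇔ Admissible u p
  admissible-shift {u} p = mk⇔
    (λ ((x₂≤x₁ , x₃≤x₂) , g≤u) → (s≤s⁻¹ x₂≤x₁ , s≤s⁻¹ x₃≤x₂) , subst (_≤ u) (g₃-shift p) g≤u)
    (λ ((x₂≤x₁ , x₃≤x₂) , g≤u) → (s≤s x₂≤x₁ , s≤s x₃≤x₂) , subst (_≤ u) (sym (g₃-shift p)) g≤u)

  diagonal-shift : ∀ p → Diagonal (shift p) ⇔ Diagonal p
  diagonal-shift p = mk⇔
    (λ (x₁≡x₂ , x₂≡x₃) → suc-injective x₁≡x₂ , suc-injective x₂≡x₃)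
    (λ (x₁≡x₂ , x₂≡x₃) → cong suc x₁≡x₂ , cong suc x₂≡x₃)

  excursion-shift : ∀ u p w → Excursion u (shift p) w ⇔ Excursion u p w
  excursion-shift u p w rewrite points-shift p w | foldl-shift p w =
    mk⇔ (All.map (to (admissible-shift _)) ∘ map⁻) (map⁺ ∘ All.map (from (admissible-shift _)))
    ×-⇔ diagonal-shift (foldl move p w)

  excursions-shift : ∀ u p k → excursions u (shift p) k ≡ excursions u p k
  excursions-shift u p k =
    count-cong (excursion? u (shift p)) (excursion? u p) (universal (excursion-shift u p) (words k))

  -- An inadmissible point is given no successors, matching excursions-inadmissible.
  successors : ℕ → Point → List Point
  successors u p with admissible? u p
  ... | yes _ = filter (admissible? u) (map (move p) steps)
  ... | no _  = []

  excursions-suc : ∀ u p k → excursions u p (suc k) ≡ sum (map (λ q → excursions u q k) (successors u p))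
  excursions-suc u p k with admissible? u p
  ... | no ¬adm = excursions-inadmissible ¬adm (suc k)
  ... | yes adm = begin
    excursions u p (suc k)
      ≡⟨ count-words-suc (excursion? u p) k ⟩
    sum (map (λ t → count (excursion? u p ∘ (t ∷_)) (words k)) steps)
      ≡⟨ cong sum (map-cong first-step steps) ⟩
    sum (map (λ t → excursions u (move p t) k) steps)
      ≡⟨ cong sum (map-∘ {g = λ q → excursions u q k} {f = move p} steps) ⟩
    sum (map (λ q → excursions u q k) (map (move p) steps))
      ≡⟨ sum-map-filter (admissible? u) (λ q → excursions u q k)
                        (λ ¬adm′ → excursions-inadmissible ¬adm′ k) (map (move p) steps) ⟨
    sum (map (λ q → excursions u q k) (filter (admissible? u) (map (move p) steps))) ∎
    where
    first-step : ∀ t → count (excursion? u p ∘ (t ∷_)) (words k) ≡ excursions u (move p t) k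
    first-step t = count-cong (excursion? u p ∘ (t ∷_)) (excursion? u (move p t))
                              (universal (excursion-∷ adm t) (words k))

  reachable : ℕ → ℕ → Point → List Point
  reachable u zero    p = p ∷ []
  reachable u (suc j) p = concatMap (reachable u j) (successors u p)

  excursions-+ : ∀ u j p k → excursions u p (j + k) ≡ sum (map (λ q → excursions u q k) (reachable u j p))
  excursions-+ u zero    p k = sym (+-identityʳ _)
  excursions-+ u (suc j) p k = begin
    excursions u p (suc j + k)
      ≡⟨ excursions-suc u p (j + k) ⟩
    sum (map (λ q → excursions u q (j + k)) (successors u p))
      ≡⟨ cong sum (map-cong (λ q → excursions-+ u j q k) (successors u p)) ⟩
    sum (map (λ q → sum (map (λ r → excursions u r k) (reachable u j q))) (successors u p))
      ≡⟨ sum-map-concatMap _ (reachable u j) (successors u p) ⟨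
    sum (map (λ q → excursions u q k) (reachable u (suc j) p)) ∎

  foldl-move : ∀ x₁ x₂ x₃ w →
    foldl move (x₁ , x₂ , x₃) w ≡ (x₁ + occ zero w , x₂ + occ (suc zero) w , x₃ + occ (suc (suc zero)) w)
  foldl-move x₁ x₂ x₃ [] = sym (cong₂ _,_ (+-identityʳ x₁) (cong₂ _,_ (+-identityʳ x₂) (+-identityʳ x₃)))
  foldl-move x₁ x₂ x₃ (zero ∷ w)
    rewrite +-suc x₁ (occ zero w) = foldl-move (suc x₁) x₂ x₃ w
  foldl-move x₁ x₂ x₃ (suc zero ∷ w)
    rewrite +-suc x₂ (occ (suc zero) w) = foldl-move x₁ (suc x₂) x₃ w
  foldl-move x₁ x₂ x₃ (suc (suc zero) ∷ w)
    rewrite +-suc x₃ (occ (suc (suc zero)) w) = foldl-move x₁ x₂ (suc x₃) w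

  occ-sum : ∀ w → occ zero w + occ (suc zero) w + occ (suc (suc zero)) w ≡ length w
  occ-sum []                   = refl
  occ-sum (zero ∷ w)           = cong suc (occ-sum w)
  occ-sum (suc zero ∷ w)
    rewrite +-suc (occ zero w) (occ (suc zero) w) = cong suc (occ-sum w)
  occ-sum (suc (suc zero) ∷ w)
    rewrite +-suc (occ zero w + occ (suc zero) w) (occ (suc (suc zero)) w) = cong suc (occ-sum w)

  diagonal-thirds : ∀ {a b c} n → Diagonal (a , b , c) → a + b + c ≡ 3 * n → a ≡ n × b ≡ n × c ≡ n
  diagonal-thirds {a} n (refl , refl) a+a+a≡3n = a≡n , a≡n , a≡n
    where
    three-times : ∀ a → 3 * a ≡ a + a + a
    three-times = solve-∀
    a≡n : a ≡ n
    a≡n = *-cancelˡ-≡ a n 3 (trans (three-times a) a+a+a≡3n)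

  good⇔excursion : ∀ u n {w} → length w ≡ 3 * n → Good u n w ⇔ Excursion u origin w
  good⇔excursion u n {w} len = mk⇔
    (λ (adms , o₁ , o₂ , o₃) →
       adms , subst Diagonal (sym (foldl-move 0 0 0 w)) (trans o₁ (sym o₂) , trans o₂ (sym o₃)))
    (λ (adms , diag) →
       adms , diagonal-thirds n (subst Diagonal (foldl-move 0 0 0 w) diag) (trans (occ-sum w) len))

  Chat≡excursions : ∀ u n → Chat u n ≡ excursions u origin (3 * n)
  Chat≡excursions u n = trans (length-filter≡count (good? u n) (words (3 * n)))
    (count-cong (good? u n) (excursion? u origin) (All.map (good⇔excursion u n) (words-length (3 * n))))

  from-origin from-210 : ℕ → ℕ
  from-origin n = excursions 4 origin (3 * n)
  from-210    n = excursions 4 (2 , 1 , 0) (3 * n)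

  -- reachable 4 3 origin evaluates to (2,1,0), (2,1,0), (1,1,1).
  from-origin-suc : ∀ n → from-origin (suc n) ≡ 1 * from-origin n + 2 * from-210 n
  from-origin-suc n = begin
    excursions 4 origin (3 * suc n)                ≡⟨ cong (excursions 4 origin) (*-suc 3 n) ⟩
    excursions 4 origin (3 + k)                    ≡⟨ excursions-+ 4 3 origin k ⟩
    e + (e + (excursions 4 (shift origin) k + 0))  ≡⟨ cong (λ z → e + (e + (z + 0))) (excursions-shift 4 origin k) ⟩
    e + (e + (a + 0))                              ≡⟨ regroup a e ⟩
    1 * a + 2 * e                                  ∎
    where
    k a e : ℕ
    k = 3 * n
    a = from-origin n
    e = from-210 n
    regroup : ∀ a e → e + (e + (a + 0)) ≡ 1 * a + 2 * e
    regroup = solve-∀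

  -- reachable 4 3 (2,1,0) evaluates to (3,2,1), (2,2,2), (3,2,1), (3,2,1), (2,2,2).
  from-210-suc : ∀ n → from-210 (suc n) ≡ 2 * from-origin n + 3 * from-210 n
  from-210-suc n = begin
    excursions 4 (2 , 1 , 0) (3 * suc n)  ≡⟨ cong (excursions 4 (2 , 1 , 0)) (*-suc 3 n) ⟩
    excursions 4 (2 , 1 , 0) (3 + k)      ≡⟨ excursions-+ 4 3 (2 , 1 , 0) k ⟩
    e′ + (a″ + (e′ + (e′ + (a″ + 0))))    ≡⟨ cong₂ (λ x y → x + (y + (x + (x + (y + 0))))) e′≡e a″≡a ⟩
    e + (a + (e + (e + (a + 0))))         ≡⟨ regroup a e ⟩
    2 * a + 3 * e                         ∎
    where
    k a e e′ a″ : ℕ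
    k = 3 * n
    a = from-origin n
    e = from-210 n
    e′ = excursions 4 (shift (2 , 1 , 0)) k
    a″ = excursions 4 (shift (shift origin)) k
    e′≡e : e′ ≡ e
    e′≡e = excursions-shift 4 (2 , 1 , 0) k
    a″≡a : a″ ≡ a
    a″≡a = trans (excursions-shift 4 (shift origin) k) (excursions-shift 4 origin k)
    regroup : ∀ a e → e + (a + (e + (e + (a + 0)))) ≡ 2 * a + 3 * e
    regroup = solve-∀

module Conjugation where
  import Data.Nat as ℕ
  open import Data.Integer using (ℤ; _+_; _*_; _-_)
  open import Data.Integer.Properties using (pos-+; pos-*)
  open import Data.Integer.Tactic.RingSolver using (solve-∀)

  α : ℤ√5
  α = + 2 , - + 1

  conj : ℤ√5 → ℤ√5
  conj (x , y) = x , - y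

  -- The integer identities below are stated exactly as the components of ⊗ and ⊖ unfold,
  -- so the solver's proofs apply up to conversion.
  conj-⊗ : ∀ x y → conj (x ⊗ y) ≡ conj x ⊗ conj y
  conj-⊗ (x₁ , x₂) (y₁ , y₂) = cong₂ _,_ (rational x₁ x₂ y₁ y₂) (irrational x₁ x₂ y₁ y₂)
    where
    rational : ∀ a b c d → a * c + + 5 * (b * d) ≡ a * c + + 5 * (- b * - d)
    rational = solve-∀
    irrational : ∀ a b c d → - (a * d + b * c) ≡ a * - d + - b * c
    irrational = solve-∀

  conj-^√ : ∀ x n → conj (x ^√ n) ≡ conj x ^√ n
  conj-^√ x zero    = refl
  conj-^√ x (suc n) = trans (conj-⊗ x (x ^√ n)) (cong (conj x ⊗_) (conj-^√ x n))

  pos-linear : ∀ c m d n → + (c ℕ.* m ℕ.+ d ℕ.* n) ≡ + c * + m + + d * + n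
  pos-linear c m d n = trans (pos-+ (c ℕ.* m) (d ℕ.* n)) (cong₂ _+_ (pos-* c m) (pos-* d n))

  closed-form : ∀ {c} x → + c ≡ proj₁ x + proj₂ x →
                (+ 0 , + 2) ⊗ ι c ≡ (+ 1 , + 1) ⊗ x ⊖ (+ 1 , - + 1) ⊗ conj x
  closed-form (p , q) c≡p+q = trans (cong (λ z → (+ 0 , + 2) ⊗ (z , + 0)) c≡p+q)
                                    (cong₂ _,_ (rational p q) (irrational p q))
    where
    rational : ∀ p q → + 0 * (p + q) + + 5 * (+ 2 * + 0) ≡ (+ 1 * p + + 5 * (+ 1 * q)) - (+ 1 * p + + 5 * (- + 1 * - q))
    rational = solve-∀
    irrational : ∀ p q → + 0 * + 0 + + 2 * (p + q) ≡ (+ 1 * q + + 1 * p) - (+ 1 * - q + - + 1 * p)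
    irrational = solve-∀

  module _ (a e : ℕ → ℕ) (a-zero : a 0 ≡ 1) (e-zero : e 0 ≡ 0)
           (a-suc : ∀ n → a (suc n) ≡ 1 ℕ.* a n ℕ.+ 2 ℕ.* e n)
           (e-suc : ∀ n → e (suc n) ≡ 2 ℕ.* a n ℕ.+ 3 ℕ.* e n) where

    α^√-components : ∀ n → + a n ≡ proj₁ (α ^√ n) + proj₂ (α ^√ n) × + e n ≡ - (+ 2 * proj₂ (α ^√ n))
    α^√-components zero rewrite a-zero | e-zero = refl , refl
    α^√-components (suc n) = step-a , step-e
      where
      p q : ℤ
      p = proj₁ (α ^√ n)
      q = proj₂ (α ^√ n)
      ih : + a n ≡ p + q × + e n ≡ - (+ 2 * q)
      ih = α^√-components n
      identity-a : ∀ p q → + 1 * (p + q) + + 2 * - (+ 2 * q) ≡ (+ 2 * p + + 5 * (- + 1 * q)) + (+ 2 * q + - + 1 * p)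
      identity-a = solve-∀
      identity-e : ∀ p q → + 2 * (p + q) + + 3 * - (+ 2 * q) ≡ - (+ 2 * (+ 2 * q + - + 1 * p))
      identity-e = solve-∀
      step-a : + a (suc n) ≡ proj₁ (α ^√ suc n) + proj₂ (α ^√ suc n)
      step-a = begin
        + a (suc n)                              ≡⟨ cong +_ (a-suc n) ⟩
        + (1 ℕ.* a n ℕ.+ 2 ℕ.* e n)              ≡⟨ pos-linear 1 (a n) 2 (e n) ⟩
        + 1 * + a n + + 2 * + e n                ≡⟨ cong₂ (λ x y → + 1 * x + + 2 * y) (proj₁ ih) (proj₂ ih) ⟩
        + 1 * (p + q) + + 2 * - (+ 2 * q)        ≡⟨ identity-a p q ⟩
        proj₁ (α ^√ suc n) + proj₂ (α ^√ suc n) ∎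
      step-e : + e (suc n) ≡ - (+ 2 * proj₂ (α ^√ suc n))
      step-e = begin
        + e (suc n)                              ≡⟨ cong +_ (e-suc n) ⟩
        + (2 ℕ.* a n ℕ.+ 3 ℕ.* e n)              ≡⟨ pos-linear 2 (a n) 3 (e n) ⟩
        + 2 * + a n + + 3 * + e n                ≡⟨ cong₂ (λ x y → + 2 * x + + 3 * y) (proj₁ ih) (proj₂ ih) ⟩
        + 2 * (p + q) + + 3 * - (+ 2 * q)        ≡⟨ identity-e p q ⟩
        - (+ 2 * proj₂ (α ^√ suc n))             ∎

    closed-form-a : ∀ n → (+ 0 , + 2) ⊗ ι (a n) ≡ (+ 1 , + 1) ⊗ (α ^√ n) ⊖ (+ 1 , - + 1) ⊗ (conj α ^√ n)
    closed-form-a n = trans (closed-form (α ^√ n) (proj₁ (α^√-components n)))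
                            (cong (λ y → (+ 1 , + 1) ⊗ (α ^√ n) ⊖ (+ 1 , - + 1) ⊗ y) (conj-^√ α n))

open Excursions using (Chat≡excursions; from-origin; from-210; from-origin-suc; from-210-suc)
open Conjugation using (closed-form-a)

corollary4p3 : (n : ℕ) →
    (+ 0 , + 2) ⊗ ι (Chat 4 n) ≡
      (+ 1 , + 1) ⊗ ((+ 2 , - (+ 1)) ^√ n) ⊖ (+ 1 , - (+ 1)) ⊗ ((+ 2 , + 1) ^√ n)
corollary4p3 n = begin
  (+ 0 , + 2) ⊗ ι (Chat 4 n)
    ≡⟨ cong (λ c → (+ 0 , + 2) ⊗ ι c) (Chat≡excursions 4 n) ⟩
  (+ 0 , + 2) ⊗ ι (from-origin n)
    ≡⟨ closed-form-a from-origin from-210 refl refl from-origin-suc from-210-suc n ⟩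
  (+ 1 , + 1) ⊗ ((+ 2 , - (+ 1)) ^√ n) ⊖ (+ 1 , - (+ 1)) ⊗ ((+ 2 , + 1) ^√ n) ∎
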